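{- Let $D$ be the formal derivative with respect to the context-free grammar $x \rightarrow xy,\ y \rightarrow x^2$. For every integer $n\geq 1$, \[ D^n(x)=\sum_{k=0}^{\lfloor n/2\rfloor} T(n,k)\, x^{2k+1}y^{n-2k}, \] where $T(n,k)$ is the number of permutations of $[n]$ with exactly $k$ exterior peaks.
   Context: The formal derivative $D$ with respect to a grammar is the unique linear operator on polynomials in the letters that sends each letter to its image under the grammar's rule and satisfies the Leibniz rule $D(uv)=D(u)v+uD(v)$. For a permutation $\pi=\pi_1\pi_2\cdots\pi_n$ of $[n]$, an index $i$ is an exterior peak if either $1<i<n$ and $\pi_{i-1}<\pi_i>\pi_{i+1}$, or $i=1$ (with $n\geq 2$) and $\pi_1>\pi_2$. (The index $i=n$ is never an exterior peak.) -}

module Defs where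

open import Data.Nat using (ℕ; zero; suc; _+_; _*_; _∸_; _<ᵇ_; _≡ᵇ_; _/_)
open import Data.Bool using (Bool; true; false; if_then_else_; _∧_; not)
open import Data.Fin using (Fin; toℕ)
open import Data.List using (List; []; _∷_; map; concatMap; filterᵇ; length; foldr; upTo; allFin)
open import Data.Bool.ListAction using (any)
open import Data.Vec using (Vec; []; _∷_; toList)
open import Level using (0ℓ)
open import Algebra.Bundles using (CommutativeSemiring)

data Expr : Set where
  X Y : Expr
  lit : ℕ → Expr
  _⊕_ _⊗_ : Expr → Expr → Expr

infixl 6 _⊕_
infixl 7 _⊗_

D : Expr → Expr
D X = X ⊗ Y
D Y = X ⊗ X
D (lit _) = lit 0
D (e ⊕ f) = D e ⊕ D f
D (e ⊗ f) = (D e ⊗ f) ⊕ (e ⊗ D f)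

D^ : ℕ → Expr → Expr
D^ zero e = e
D^ (suc n) e = D (D^ n e)

_^ᴱ_ : Expr → ℕ → Expr
e ^ᴱ zero = lit 1
e ^ᴱ suc n = e ⊗ (e ^ᴱ n)

module _ {c ℓ} (R : CommutativeSemiring c ℓ) where
  open CommutativeSemiring R using (Carrier; 0#; 1#) renaming (_+_ to _+ᴿ_; _*_ to _*ᴿ_)

  ⟦_⟧ : Expr → Carrier → Carrier → Carrier
  ⟦ X ⟧ a b = a
  ⟦ Y ⟧ a b = b
  ⟦ lit n ⟧ a b = natLit n
    where
    natLit : ℕ → Carrier
    natLit zero = 0#
    natLit (suc k) = 1# +ᴿ natLit k
  ⟦ e ⊕ f ⟧ a b = ⟦ e ⟧ a b +ᴿ ⟦ f ⟧ a b
  ⟦ e ⊗ f ⟧ a b = ⟦ e ⟧ a b *ᴿ ⟦ f ⟧ a b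

-- Equality in the polynomial ring ℕ[x,y] (the free commutative semiring on x, y):
-- two expressions are equal as polynomials iff they agree under every
-- evaluation in every commutative semiring.
_≈ᴾ_ : Expr → Expr → Set₁
e ≈ᴾ f = (R : CommutativeSemiring 0ℓ 0ℓ) (a b : CommutativeSemiring.Carrier R) →
         CommutativeSemiring._≈_ R (⟦ R ⟧ e a b) (⟦ R ⟧ f a b)

words : (n m : ℕ) → List (Vec (Fin m) n)
words zero m = [] ∷ []
words (suc n) m = concatMap (λ i → map (i ∷_) (words n m)) (allFin m)

distinct : List ℕ → Bool
distinct [] = true
distinct (a ∷ as) = not (any (λ b → a ≡ᵇ b) as) ∧ distinct as

-- permutations of [n], as words π₁…πₙ (value j+1 represented by j : Fin n)
perms : (n : ℕ) → List (List ℕ)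
perms n = filterᵇ distinct (map (λ v → toList (Data.Vec.map toℕ v)) (words n n))
  where import Data.Vec

interiorPeaks : List ℕ → ℕ
interiorPeaks (a ∷ b ∷ c ∷ rest) =
  (if (a <ᵇ b) ∧ (c <ᵇ b) then 1 else 0) + interiorPeaks (b ∷ c ∷ rest)
interiorPeaks _ = 0

exteriorPeaks : List ℕ → ℕ
exteriorPeaks (a ∷ b ∷ rest) = (if b <ᵇ a then 1 else 0) + interiorPeaks (a ∷ b ∷ rest)
exteriorPeaks _ = 0

T : ℕ → ℕ → ℕ
T n k = length (filterᵇ (λ π → exteriorPeaks π ≡ᵇ k) (perms n))

rhs : ℕ → Expr
rhs n = foldr (λ k acc → (lit (T n k) ⊗ (X ^ᴱ (2 * k + 1)) ⊗ (Y ^ᴱ (n ∸ 2 * k))) ⊕ acc)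
              (lit 0) (upTo (suc (n / 2)))

module Submission where

-- Evaluating at the dual numbers (a + ab ε, b + a² ε) computes D in the ε-part, so D
-- respects polynomial equality and the theorem follows by induction on n once
-- D (rhs n) = rhs (n + 1). Write rhs n as the sum over permutations π of [n] of
-- x^(2e+1) y^(n-2e), where e is the number of exterior peaks of π. Every permutation of
-- [n + 1] arises exactly once by inserting n + 1 into a permutation of [n]; of the n + 1
-- insertion points, the 2e + 1 next to a peak or at the end keep the number of exterior
-- peaks and the other n - 2e raise it by one. This is exactly
-- D (x^(2e+1) y^(n-2e)) = (2e+1) x^(2e+1) y^(n+1-2e) + (n-2e) x^(2e+3) y^(n-1-2e).

open import Algebra.Bundles using (CommutativeSemiring)
open import Data.Nat using (ℕ; zero; suc; _≤_)

open import Defs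

module Derivative where

  open import Algebra.Structures using (IsCommutativeMonoid)
  open import Algebra.Structures.Biased using (isCommutativeSemiringˡ)
  open import Data.Product using (_×_; _,_; proj₂)
  open import Data.Product.Relation.Binary.Pointwise.NonDependent using (Pointwise; ×-isEquivalence)

  module DualNumbers {c ℓ} (R : CommutativeSemiring c ℓ) where
    open CommutativeSemiring R
    open import Algebra.Solver.Ring.NaturalCoefficients.Default R using (solve; _:=_; _:+_; _:*_; con)

    Dual : Set c
    Dual = Carrier × Carrier

    infix 4 _≈ᵈ_
    _≈ᵈ_ : Dual → Dual → Set ℓ
    _≈ᵈ_ = Pointwise _≈_ _≈_

    infixl 6 _+ᵈ_
    infixl 7 _*ᵈ_
    _+ᵈ_ _*ᵈ_ : Dual → Dual → Dual
    (x , x′) +ᵈ (y , y′) = x + y , x′ + y′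
    (x , x′) *ᵈ (y , y′) = x * y , x′ * y + x * y′

    +ᵈ-isCommutativeMonoid : IsCommutativeMonoid _≈ᵈ_ _+ᵈ_ (0# , 0#)
    +ᵈ-isCommutativeMonoid = record
      { isMonoid = record
        { isSemigroup = record
          { isMagma = record
            { isEquivalence = ×-isEquivalence isEquivalence isEquivalence
            ; ∙-cong = λ (p , p′) (q , q′) → +-cong p q , +-cong p′ q′ }
          ; assoc = λ (x , x′) (y , y′) (z , z′) → +-assoc x y z , +-assoc x′ y′ z′ }
        ; identity = (λ (x , x′) → +-identityˡ x , +-identityˡ x′)
                   , (λ (x , x′) → +-identityʳ x , +-identityʳ x′) }
      ; comm = λ (x , x′) (y , y′) → +-comm x y , +-comm x′ y′ }

    *ᵈ-isCommutativeMonoid : IsCommutativeMonoid _≈ᵈ_ _*ᵈ_ (1# , 0#)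
    *ᵈ-isCommutativeMonoid = record
      { isMonoid = record
        { isSemigroup = record
          { isMagma = record
            { isEquivalence = ×-isEquivalence isEquivalence isEquivalence
            ; ∙-cong = λ (p , p′) (q , q′) → *-cong p q , +-cong (*-cong p′ q) (*-cong p q′) }
          ; assoc = λ (x , x′) (y , y′) (z , z′) → *-assoc x y z ,
              solve 6 (λ x x′ y y′ z z′ → (x′ :* y :+ x :* y′) :* z :+ (x :* y) :* z′
                                        := x′ :* (y :* z) :+ x :* (y′ :* z :+ y :* z′))
                      refl x x′ y y′ z z′ }
        ; identity = (λ (x , x′) → *-identityˡ x ,
                        solve 2 (λ x x′ → con 0 :* x :+ con 1 :* x′ := x′) refl x x′)
                   , (λ (x , x′) → *-identityʳ x ,
                        solve 2 (λ x x′ → x′ :* con 1 :+ x :* con 0 := x′) refl x x′) }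
      ; comm = λ (x , x′) (y , y′) → *-comm x y ,
          solve 4 (λ x x′ y y′ → x′ :* y :+ x :* y′ := y′ :* x :+ y :* x′) refl x x′ y y′ }

    R[ε] : CommutativeSemiring c ℓ
    R[ε] = record
      { isCommutativeSemiring = isCommutativeSemiringˡ record
        { +-isCommutativeMonoid = +ᵈ-isCommutativeMonoid
        ; *-isCommutativeMonoid = *ᵈ-isCommutativeMonoid
        ; distribʳ = λ (z , z′) (x , x′) (y , y′) → distribʳ z x y ,
            solve 6 (λ x x′ y y′ z z′ → (x′ :+ y′) :* z :+ (x :+ y) :* z′
                                      := (x′ :* z :+ x :* z′) :+ (y′ :* z :+ y :* z′))
                    refl x x′ y y′ z z′
        ; zeroˡ = λ (x , x′) → zeroˡ x ,
            solve 2 (λ x x′ → con 0 :* x :+ con 0 :* x′ := con 0) refl x x′ } }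

    ⟦⟧-at-dual : ∀ e a b →
                 ⟦ R[ε] ⟧ e (a , a * b) (b , a * a) ≈ᵈ (⟦ R ⟧ e a b , ⟦ R ⟧ (D e) a b)
    ⟦⟧-at-dual X a b = refl , refl
    ⟦⟧-at-dual Y a b = refl , refl
    ⟦⟧-at-dual (lit zero) a b = refl , refl
    ⟦⟧-at-dual (lit (suc n)) a b with p , p′ ← ⟦⟧-at-dual (lit n) a b =
      +-cong refl p , trans (+-cong refl p′) (+-identityʳ 0#)
    ⟦⟧-at-dual (e ⊕ f) a b with p , p′ ← ⟦⟧-at-dual e a b | q , q′ ← ⟦⟧-at-dual f a b =
      +-cong p q , +-cong p′ q′
    ⟦⟧-at-dual (e ⊗ f) a b with p , p′ ← ⟦⟧-at-dual e a b | q , q′ ← ⟦⟧-at-dual f a b =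
      *-cong p q , +-cong (*-cong p′ q) (*-cong p q′)

  D-cong : ∀ {e f} → e ≈ᴾ f → D e ≈ᴾ D f
  D-cong {e} {f} e≈f R a b =
    trans (sym (proj₂ (⟦⟧-at-dual e a b)))
          (trans (proj₂ (e≈f R[ε] (a , a * b) (b , a * a))) (proj₂ (⟦⟧-at-dual f a b)))
    where open CommutativeSemiring R
          open DualNumbers R

open Derivative using (D-cong)

module FiniteSums {c ℓ} (R : CommutativeSemiring c ℓ) where

  open import Data.Bool using (true; false; if_then_else_)
  import Data.Bool as Bool
  open import Data.List using (List; []; _∷_; map; length; filterᵇ; concatMap; _++_)
  open import Data.List.Membership.Propositional using (_∈_; _∉_)
  open import Data.List.Relation.Binary.Permutation.Propositional as ↭ using (_↭_; prep; swap)
  open import Data.List.Relation.Unary.All using (All; _∷_)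
  open import Data.List.Relation.Unary.All.Properties using (All¬⇒¬Any)
  open import Data.List.Relation.Unary.Any using (here; there)
  open import Data.List.Relation.Unary.Unique.Propositional using (Unique; _∷_)
  open import Data.Nat using (_≡ᵇ_)
  open import Data.Nat.Properties using (≡ᵇ⇒≡; ≡⇒≡ᵇ)
  open import Data.Unit using (tt)
  open import Function using (_∘_)
  import Relation.Binary.PropositionalEquality as ≡
  open ≡ using (_≡_)
  open import Relation.Nullary using (contradiction)

  open CommutativeSemiring R
  open import Algebra.Properties.CommutativeSemigroup +-commutativeSemigroup using (x∙yz≈y∙xz; interchange)
  open import Algebra.Properties.Semiring.Mult semiring using (_×_)
  open import Relation.Binary.Reasoning.Setoid setoid

  private variable A B : Set

  ∑ : (A → Carrier) → List A → Carrier
  ∑ f [] = 0#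
  ∑ f (x ∷ xs) = f x + ∑ f xs

  ∑-cong : ∀ {f g : A → Carrier} xs → (∀ {x} → x ∈ xs → f x ≈ g x) → ∑ f xs ≈ ∑ g xs
  ∑-cong [] _ = refl
  ∑-cong (x ∷ xs) f≈g = +-cong (f≈g (here ≡.refl)) (∑-cong xs (f≈g ∘ there))

  ∑-map : ∀ (f : B → Carrier) (g : A → B) xs → ∑ f (map g xs) ≡ ∑ (f ∘ g) xs
  ∑-map f g [] = ≡.refl
  ∑-map f g (x ∷ xs) = ≡.cong (f (g x) +_) (∑-map f g xs)

  ∑-++ : ∀ (f : A → Carrier) xs ys → ∑ f (xs ++ ys) ≈ ∑ f xs + ∑ f ys
  ∑-++ f [] ys = sym (+-identityˡ _)
  ∑-++ f (x ∷ xs) ys = trans (+-congˡ (∑-++ f xs ys)) (sym (+-assoc _ _ _))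

  ∑-concatMap : ∀ (f : B → Carrier) (g : A → List B) xs → ∑ f (concatMap g xs) ≈ ∑ (∑ f ∘ g) xs
  ∑-concatMap f g [] = refl
  ∑-concatMap f g (x ∷ xs) = trans (∑-++ f (g x) (concatMap g xs)) (+-congˡ (∑-concatMap f g xs))

  ∑-↭ : ∀ (f : A → Carrier) {xs ys} → xs ↭ ys → ∑ f xs ≈ ∑ f ys
  ∑-↭ f ↭.refl = refl
  ∑-↭ f (prep x xs↭ys) = +-congˡ (∑-↭ f xs↭ys)
  ∑-↭ f (swap x y xs↭ys) = trans (x∙yz≈y∙xz _ _ _) (+-congˡ (+-congˡ (∑-↭ f xs↭ys)))
  ∑-↭ f (↭.trans xs↭ys ys↭zs) = trans (∑-↭ f xs↭ys) (∑-↭ f ys↭zs)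

  ∑-+ : ∀ (f g : A → Carrier) xs → ∑ (λ x → f x + g x) xs ≈ ∑ f xs + ∑ g xs
  ∑-+ f g [] = sym (+-identityˡ 0#)
  ∑-+ f g (x ∷ xs) = trans (+-congˡ (∑-+ f g xs)) (interchange _ _ _ _)

  ∑-zero : ∀ (xs : List A) → ∑ (λ _ → 0#) xs ≈ 0#
  ∑-zero [] = refl
  ∑-zero (x ∷ xs) = trans (+-identityˡ _) (∑-zero xs)

  ∑-select-∉ : ∀ (h : ℕ → Carrier) {m ks} → m ∉ ks →
               ∑ (λ k → if m ≡ᵇ k then h k else 0#) ks ≈ 0#
  ∑-select-∉ h {ks = []} _ = refl
  ∑-select-∉ h {m} {k ∷ ks} m∉ with m ≡ᵇ k in m≡ᵇk
  ... | true = contradiction (here (≡ᵇ⇒≡ m k (≡.subst Bool.T (≡.sym m≡ᵇk) tt))) m∉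
  ... | false = trans (+-identityˡ _) (∑-select-∉ h (m∉ ∘ there))

  ∑-select : ∀ (h : ℕ → Carrier) {m ks} → Unique ks → m ∈ ks →
             ∑ (λ k → if m ≡ᵇ k then h k else 0#) ks ≈ h m
  ∑-select h {m} {k ∷ ks} (k∉ks ∷ u) m∈ with m ≡ᵇ k in m≡ᵇk | m∈
  ... | true | _ with ≡.refl ← ≡ᵇ⇒≡ m k (≡.subst Bool.T (≡.sym m≡ᵇk) tt) =
    trans (+-congˡ (∑-select-∉ h (All¬⇒¬Any k∉ks))) (+-identityʳ (h m))
  ... | false | here ≡.refl with () ← ≡.subst Bool.T m≡ᵇk (≡⇒≡ᵇ m m ≡.refl)
  ... | false | there m∈ks = trans (+-identityˡ _) (∑-select h u m∈ks)

  module _ (g : A → ℕ) (h : ℕ → Carrier) where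

    private
      count : List A → ℕ → ℕ
      count xs k = length (filterᵇ (λ x → g x ≡ᵇ k) xs)

      count-∷ : ∀ x xs k → count (x ∷ xs) k × h k ≈ (if g x ≡ᵇ k then h k else 0#) + count xs k × h k
      count-∷ x xs k with g x ≡ᵇ k
      ... | true = refl
      ... | false = sym (+-identityˡ _)

    ∑-group : ∀ {ks} xs → Unique ks → All (λ x → g x ∈ ks) xs →
              ∑ (λ k → length (filterᵇ (λ x → g x ≡ᵇ k) xs) × h k) ks ≈ ∑ (h ∘ g) xs
    ∑-group {ks} [] _ _ = ∑-zero ks
    ∑-group {ks} (x ∷ xs) u (gx∈ks ∷ gxs∈ks) = begin
      ∑ (λ k → count (x ∷ xs) k × h k) ks
        ≈⟨ ∑-cong ks (λ {k} _ → count-∷ x xs k) ⟩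
      ∑ (λ k → (if g x ≡ᵇ k then h k else 0#) + count xs k × h k) ks
        ≈⟨ ∑-+ _ _ ks ⟩
      ∑ (λ k → if g x ≡ᵇ k then h k else 0#) ks + ∑ (λ k → count xs k × h k) ks
        ≈⟨ +-cong (∑-select h u gx∈ks) (∑-group xs u gxs∈ks) ⟩
      h (g x) + ∑ (h ∘ g) xs ∎

module Permutations where

  open import Data.Bool using (true; false; not)
  import Data.Bool as Bool
  open import Data.Bool.ListAction using (any)
  open import Data.Bool.Properties using (T-∧)
  open import Data.Empty using (⊥)
  open import Data.Fin using (Fin; toℕ; fromℕ<)
  open import Data.Fin.Properties using (toℕ<n; toℕ-injective; toℕ-fromℕ<)
  open import Data.List using (List; []; _∷_; map; concatMap; length; allFin)
  open import Data.List.Properties using (∷-injective; ∷-injectiveˡ; ∷-injectiveʳ; map-∘)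
  open import Data.List.Membership.Propositional using (_∈_; _∉_)
  open import Data.List.Membership.Propositional.Properties
    using (∈-map⁺; ∈-map⁻; ∈-concat⁺′; ∈-concat⁻′; ∈-allFin; ∈-filter⁺; ∈-filter⁻)
  open import Data.List.Membership.Propositional.Properties.WithK using (unique∧set⇒bag)
  open import Data.List.Relation.Binary.BagAndSetEquality using (∼bag⇒↭)
  open import Data.List.Relation.Binary.Permutation.Propositional
    using (_↭_; ↭-refl; ↭-prep; ↭-swap; ↭-trans; ↭-sym; ↭⇒↭ₛ)
  open import Data.List.Relation.Binary.Permutation.Propositional.Properties using (↭-length; All-resp-↭)
  import Data.List.Relation.Binary.Permutation.Setoid.Properties as ↭ₛ
  open import Data.List.Relation.Unary.All as All using (All; []; _∷_)
  open import Data.List.Relation.Unary.All.Properties using (¬Any⇒All¬; All¬⇒¬Any)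
  import Data.List.Relation.Unary.AllPairs as AllPairs
  open import Data.List.Relation.Unary.Any using (here; there)
  open import Data.List.Relation.Unary.Unique.Propositional using (Unique; []; _∷_)
  open import Data.List.Relation.Unary.Unique.Propositional.Properties
    using (++⁺; map⁺; filter⁺; allFin⁺; Unique[x∷xs]⇒x∉xs)
  open import Data.Nat using (_<_; _≡ᵇ_; _≟_; z≤n; s≤s; s≤s⁻¹)
  open import Data.Nat.Properties
    using (≡ᵇ⇒≡; ≡⇒≡ᵇ; ≤∧≢⇒<; <-irrefl; n≤1+n; n<1+n; m<n⇒m<1+n; >⇒≢; ≤-trans;
           suc-injective)
  open import Data.List.Membership.DecPropositional _≟_ using (_∈?_)
  open import Data.Product using (_×_; _,_; proj₁; proj₂; ∃-syntax)
  open import Data.Unit using (tt)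
  open import Data.Vec as Vec using (Vec; []; _∷_; toList)
  open import Data.Vec.Properties using () renaming (∷-injectiveʳ to Vec-∷-injectiveʳ)
  open import Function using (_∘_; _⇔_; mk⇔; Equivalence)
  open import Relation.Binary.Definitions using (DecidableEquality)
  open import Relation.Binary.PropositionalEquality
    using (_≡_; _≢_; refl; sym; trans; cong; cong₂; subst; setoid; module ≡-Reasoning)
  open import Relation.Nullary using (yes; no; contradiction)

  T-not-any-≡ᵇ : ∀ a as → Bool.T (not (any (a ≡ᵇ_) as)) ⇔ All (a ≢_) as
  T-not-any-≡ᵇ a [] = mk⇔ (λ _ → []) (λ _ → tt)
  T-not-any-≡ᵇ a (b ∷ as) with a ≡ᵇ b in a≡ᵇb
  ... | true  = mk⇔ (λ ()) (λ { (a≢b ∷ _) → a≢b (≡ᵇ⇒≡ a b (subst Bool.T (sym a≡ᵇb) tt)) })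
  ... | false = mk⇔ (λ t → (λ a≡b → subst Bool.T a≡ᵇb (≡⇒≡ᵇ a b a≡b)) ∷ to t)
                    (λ { (_ ∷ a∉as) → from a∉as })
    where open Equivalence (T-not-any-≡ᵇ a as)

  T-distinct : ∀ π → Bool.T (distinct π) ⇔ Unique π
  T-distinct [] = mk⇔ (λ _ → []) (λ _ → tt)
  T-distinct (a ∷ as) = mk⇔
    (λ t → let fresh , rest = Equivalence.to T-∧ t in to fresh ∷ Equivalence.to (T-distinct as) rest)
    (λ { (a∉as ∷ u) → Equivalence.from T-∧ (from a∉as , Equivalence.from (T-distinct as) u) })
    where open Equivalence (T-not-any-≡ᵇ a as)

  Unique-resp-↭ : ∀ {A : Set} {xs ys : List A} → xs ↭ ys → Unique xs → Unique ys
  Unique-resp-↭ {A} = ↭ₛ.Unique-resp-↭ (setoid A) ∘ ↭⇒↭ₛ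

  unique-concatMap : ∀ {A B : Set} (f : A → List B) (r : B → A) {xs} → Unique xs →
                     (∀ {x} → x ∈ xs → Unique (f x)) →
                     (∀ {x y} → x ∈ xs → y ∈ f x → r y ≡ x) →
                     Unique (concatMap f xs)
  unique-concatMap f r {[]} _ _ _ = []
  unique-concatMap f r {x ∷ xs} (x∉xs ∷ u) unique-f r-inv =
    ++⁺ (unique-f (here refl)) (unique-concatMap f r u (unique-f ∘ there) (r-inv ∘ there)) disjoint
    where
    disjoint : ∀ {v} → v ∈ f x × v ∈ concatMap f xs → ⊥
    disjoint (v∈fx , v∈rest) with ys , v∈ys , ys∈ ← ∈-concat⁻′ (map f xs) v∈rest
                             with y , y∈xs , refl ← ∈-map⁻ f ys∈ =
      All.lookup x∉xs y∈xs (trans (sym (r-inv (here refl) v∈fx)) (r-inv (there y∈xs) v∈ys))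

  ∈-words : ∀ {m n} (v : Vec (Fin m) n) → v ∈ words n m
  ∈-words [] = here refl
  ∈-words {m} {suc n} (i ∷ v) =
    ∈-concat⁺′ (∈-map⁺ (i ∷_) (∈-words v)) (∈-map⁺ (λ j → map (j ∷_) (words n m)) (∈-allFin i))

  words-unique : ∀ n m → Unique (words n m)
  words-unique zero m = [] ∷ []
  words-unique (suc n) m =
    unique-concatMap _ Vec.head (allFin⁺ m) (λ _ → map⁺ Vec-∷-injectiveʳ (words-unique n m)) head-inv
    where
    head-inv : ∀ {i v} → i ∈ allFin m → v ∈ map (i ∷_) (words n m) → Vec.head v ≡ i
    head-inv _ v∈ with _ , _ , refl ← ∈-map⁻ _ v∈ = refl

  values : ∀ {m n} → Vec (Fin m) n → List ℕ
  values v = toList (Vec.map toℕ v)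

  values-injective : ∀ {m n} {v w : Vec (Fin m) n} → values v ≡ values w → v ≡ w
  values-injective {v = []} {[]} _ = refl
  values-injective {v = i ∷ v} {j ∷ w} eq with i≡j , v≡w ← ∷-injective eq =
    cong₂ _∷_ (toℕ-injective i≡j) (values-injective v≡w)

  values-length : ∀ {m n} (v : Vec (Fin m) n) → length (values v) ≡ n
  values-length [] = refl
  values-length (i ∷ v) = cong suc (values-length v)

  values-bounded : ∀ {m n} (v : Vec (Fin m) n) → All (_< m) (values v)
  values-bounded [] = []
  values-bounded (i ∷ v) = toℕ<n i ∷ values-bounded v

  values-surjective : ∀ {m π} → All (_< m) π → ∃[ v ] values {m} {length π} v ≡ π
  values-surjective [] = [] , refl
  values-surjective (x<m ∷ bounded) with v , values-v ← values-surjective bounded =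
    fromℕ< x<m ∷ v , cong₂ _∷_ (toℕ-fromℕ< x<m) values-v

  IsPermutation : ℕ → List ℕ → Set
  IsPermutation n π = length π ≡ n × All (_< n) π × Unique π

  ∈-perms⁻ : ∀ {n π} → π ∈ perms n → IsPermutation n π
  ∈-perms⁻ {n} π∈
    with π∈values , distinctπ ← ∈-filter⁻ (Bool.T? ∘ distinct) {xs = map values (words n n)} π∈
    with v , _ , refl ← ∈-map⁻ values π∈values =
    values-length v , values-bounded v , Equivalence.to (T-distinct _) distinctπ

  ∈-perms⁺ : ∀ {n π} → IsPermutation n π → π ∈ perms n
  ∈-perms⁺ {π = π} (refl , bounded , unique) with v , values-v ← values-surjective bounded =
    ∈-filter⁺ (Bool.T? ∘ distinct)
      (subst (_∈ map values (words _ _)) values-v (∈-map⁺ values (∈-words v)))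
      (Equivalence.from (T-distinct π) unique)

  perms-unique : ∀ n → Unique (perms n)
  perms-unique n = filter⁺ (Bool.T? ∘ distinct) (map⁺ values-injective (words-unique n n))

  insertions : ∀ {A : Set} → A → List A → List (List A)
  insertions x [] = (x ∷ []) ∷ []
  insertions x (y ∷ ys) = (x ∷ y ∷ ys) ∷ map (y ∷_) (insertions x ys)

  module _ {A : Set} where

    insertions-head : ∀ (x : A) ys → (x ∷ ys) ∈ insertions x ys
    insertions-head x [] = here refl
    insertions-head x (y ∷ ys) = here refl

    insertions-↭ : ∀ {x : A} ys {zs} → zs ∈ insertions x ys → zs ↭ x ∷ ys
    insertions-↭ [] (here refl) = ↭-refl
    insertions-↭ (y ∷ ys) (here refl) = ↭-refl
    insertions-↭ {x} (y ∷ ys) (there zs∈) with zs′ , zs′∈ , refl ← ∈-map⁻ (y ∷_) zs∈ =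
      ↭-trans (↭-prep y (insertions-↭ ys zs′∈)) (↭-swap y x ↭-refl)

    insertions-unique : ∀ {x : A} {ys} → x ∉ ys → Unique (insertions x ys)
    insertions-unique {ys = []} _ = [] ∷ []
    insertions-unique {x} {y ∷ ys} x∉ =
      All.tabulate head-fresh ∷ map⁺ ∷-injectiveʳ (insertions-unique (x∉ ∘ there))
      where
      head-fresh : ∀ {zs} → zs ∈ map (y ∷_) (insertions x ys) → x ∷ y ∷ ys ≢ zs
      head-fresh zs∈ eq with _ , _ , refl ← ∈-map⁻ _ zs∈ = x∉ (here (∷-injectiveˡ eq))

    insertions-map : ∀ {B : Set} (f : A → B) x ys →
                     map (map f) (insertions x ys) ≡ insertions (f x) (map f ys)
    insertions-map f x [] = refl
    insertions-map f x (y ∷ ys) = cong ((f x ∷ f y ∷ map f ys) ∷_) (begin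
      map (map f) (map (y ∷_) (insertions x ys))   ≡⟨ map-∘ (insertions x ys) ⟨
      map (map f ∘ (y ∷_)) (insertions x ys)       ≡⟨ map-∘ (insertions x ys) ⟩
      map (f y ∷_) (map (map f) (insertions x ys)) ≡⟨ cong (map (f y ∷_)) (insertions-map f x ys) ⟩
      map (f y ∷_) (insertions (f x) (map f ys))   ∎)
      where open ≡-Reasoning

  module Deletion {A : Set} (_≟ᴬ_ : DecidableEquality A) where

    delete : A → List A → List A
    delete x [] = []
    delete x (y ∷ ys) with x ≟ᴬ y
    ... | yes _ = ys
    ... | no _ = y ∷ delete x ys

    delete-head : ∀ x ys → delete x (x ∷ ys) ≡ ys
    delete-head x ys with x ≟ᴬ x
    ... | yes _ = refl
    ... | no x≢x = contradiction refl x≢x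

    delete-insertions : ∀ {x} ys {zs} → x ∉ ys → zs ∈ insertions x ys → delete x zs ≡ ys
    delete-insertions [] _ (here refl) = delete-head _ []
    delete-insertions (y ∷ ys) _ (here refl) = delete-head _ (y ∷ ys)
    delete-insertions {x} (y ∷ ys) x∉ (there zs∈) with zs′ , zs′∈ , refl ← ∈-map⁻ (y ∷_) zs∈
                                                 with x ≟ᴬ y
    ... | yes x≡y = contradiction (here x≡y) x∉
    ... | no _ = cong (y ∷_) (delete-insertions ys (x∉ ∘ there) zs′∈)

    insertions-delete : ∀ {x} ys → x ∈ ys → ys ∈ insertions x (delete x ys)
    insertions-delete {x} (y ∷ ys) x∈ with x ≟ᴬ y | x∈
    ... | yes refl | _ = insertions-head x ys
    ... | no x≢y | here x≡y = contradiction x≡y x≢y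
    ... | no _ | there x∈ys = there (∈-map⁺ (y ∷_) (insertions-delete ys x∈ys))

    delete-↭ : ∀ {x ys} → x ∈ ys → ys ↭ x ∷ delete x ys
    delete-↭ {ys = ys} x∈ = insertions-↭ _ (insertions-delete ys x∈)

  open Deletion _≟_

  bounded-pred : ∀ {m l} → All (_< suc m) l → m ∉ l → All (_< m) l
  bounded-pred bounded m∉ =
    All.zipWith (λ (x<1+m , m≢x) → ≤∧≢⇒< (s≤s⁻¹ x<1+m) (m≢x ∘ sym))
                (bounded , ¬Any⇒All¬ _ m∉)

  bounded⇒∉ : ∀ {m l} → All (_< m) l → m ∉ l
  bounded⇒∉ bounded = All¬⇒¬Any (All.map >⇒≢ bounded)

  delete-largest : ∀ {m l} → Unique l → All (_< suc m) l → m ∈ l →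
                   length l ≡ suc (length (delete m l)) × All (_< m) (delete m l) × Unique (delete m l)
  delete-largest {m} u bounded m∈ =
    ↭-length l↭ ,
    bounded-pred (All.tail (All-resp-↭ l↭ bounded)) (Unique[x∷xs]⇒x∉xs u′) ,
    AllPairs.tail u′
    where
    l↭ = delete-↭ m∈
    u′ = Unique-resp-↭ l↭ u

  unique∧bounded⇒length≤ : ∀ m {l} → Unique l → All (_< m) l → length l ≤ m
  unique∧bounded⇒length≤ zero {[]} _ _ = z≤n
  unique∧bounded⇒length≤ zero {_ ∷ _} _ (() ∷ _)
  unique∧bounded⇒length≤ (suc m) {l} u bounded with m ∈? l
  ... | no m∉l = ≤-trans (unique∧bounded⇒length≤ m u (bounded-pred bounded m∉l)) (n≤1+n m)
  ... | yes m∈l with len , bounded′ , u′ ← delete-largest u bounded m∈l =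
    subst (_≤ suc m) (sym len) (s≤s (unique∧bounded⇒length≤ m u′ bounded′))

  largest-∈ : ∀ {n π} → IsPermutation (suc n) π → n ∈ π
  largest-∈ {n} {π} (len , bounded , u) with n ∈? π
  ... | yes n∈π = n∈π
  ... | no n∉π =
    contradiction (subst (_≤ n) len (unique∧bounded⇒length≤ n u (bounded-pred bounded n∉π)))
                  (<-irrefl refl)

  IsPermutation-delete : ∀ {n π} → IsPermutation (suc n) π → IsPermutation n (delete n π)
  IsPermutation-delete p@(len , bounded , u)
    with len′ , bounded′ , u′ ← delete-largest u bounded (largest-∈ p) =
    suc-injective (trans (sym len′) len) , bounded′ , u′

  IsPermutation-insertions : ∀ {n π π′} → IsPermutation n π → π′ ∈ insertions n π →
                             IsPermutation (suc n) π′
  IsPermutation-insertions {n} (len , bounded , u) π′∈ =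
    trans (↭-length π′↭) (cong suc len) ,
    All-resp-↭ (↭-sym π′↭) (n<1+n n ∷ All.map m<n⇒m<1+n bounded) ,
    Unique-resp-↭ (↭-sym π′↭) (All.map >⇒≢ bounded ∷ u)
    where π′↭ = insertions-↭ _ π′∈

  perms-suc-↭ : ∀ n → perms (suc n) ↭ concatMap (insertions n) (perms n)
  perms-suc-↭ n = ∼bag⇒↭ (unique∧set⇒bag (perms-unique (suc n)) insertions-perms-unique (mk⇔ to from))
    where
    n∉ : ∀ {π} → π ∈ perms n → n ∉ π
    n∉ π∈ = bounded⇒∉ (proj₁ (proj₂ (∈-perms⁻ π∈)))

    insertions-perms-unique : Unique (concatMap (insertions n) (perms n))
    insertions-perms-unique = unique-concatMap (insertions n) (delete n) (perms-unique n)
      (insertions-unique ∘ n∉) (λ π∈ → delete-insertions _ (n∉ π∈))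

    to : ∀ {π} → π ∈ perms (suc n) → π ∈ concatMap (insertions n) (perms n)
    to π∈ = ∈-concat⁺′ (insertions-delete _ (largest-∈ p))
                       (∈-map⁺ (insertions n) (∈-perms⁺ (IsPermutation-delete p)))
      where p = ∈-perms⁻ π∈

    from : ∀ {π′} → π′ ∈ concatMap (insertions n) (perms n) → π′ ∈ perms (suc n)
    from π′∈ with _ , π′∈ins , ins∈ ← ∈-concat⁻′ (map (insertions n) (perms n)) π′∈
             with π , π∈ , refl ← ∈-map⁻ (insertions n) ins∈ =
      ∈-perms⁺ (IsPermutation-insertions (∈-perms⁻ π∈) π′∈ins)

open Permutations

module Peaks where

  open import Data.Bool using (true; false; _∧_; if_then_else_)
  import Data.Bool as Bool
  open import Data.Bool.Properties using (∧-zeroʳ; T-∧; T-≡)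
  open import Data.List using (List; []; _∷_; map; length)
  open import Data.List.Properties using (length-map)
  open import Data.Nat using (_+_; _*_; _<_; _<ᵇ_; z≤n; s≤s; _/_)
  open import Data.Nat.Properties using (<ᵇ⇒<; <⇒<ᵇ; <⇒≱; <⇒≤; *-comm; +-suc; m≤n⇒m≤1+n)
  open import Data.Nat.DivMod using (m*n/n≡m; /-monoˡ-≤)
  open import Data.Product using (proj₂)
  open import Data.Unit using (tt)
  open import Function using (Equivalence)
  open import Relation.Binary.PropositionalEquality using (_≡_; refl; sym; trans; cong; subst; subst₂)
  open import Relation.Nullary using (contradiction)

  <ᵇ-true : ∀ {m n} → m < n → (m <ᵇ n) ≡ true
  <ᵇ-true m<n = Equivalence.to T-≡ (<⇒<ᵇ m<n)

  <ᵇ-false : ∀ {m n} → n ≤ m → (m <ᵇ n) ≡ false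
  <ᵇ-false {m} {n} n≤m with m <ᵇ n in m<ᵇn
  ... | false = refl
  ... | true = contradiction n≤m (<⇒≱ (<ᵇ⇒< m n (subst Bool.T (sym m<ᵇn) tt)))

  peakIndicator : ℕ → ℕ → List ℕ → ℕ
  peakIndicator z a [] = 0
  peakIndicator z a (b ∷ _) = if (z <ᵇ a) ∧ (b <ᵇ a) then 1 else 0

  interiorPeaks-∷ : ∀ z a l → interiorPeaks (z ∷ a ∷ l) ≡ peakIndicator z a l + interiorPeaks (a ∷ l)
  interiorPeaks-∷ z a [] = refl
  interiorPeaks-∷ z a (b ∷ l) = refl

  peakIndicator-below : ∀ {z a} l → a ≤ z → peakIndicator z a l ≡ 0
  peakIndicator-below [] _ = refl
  peakIndicator-below (b ∷ l) a≤z rewrite <ᵇ-false a≤z = refl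

  peakIndicator-above : ∀ {z a b} l → a < b → peakIndicator z a (b ∷ l) ≡ 0
  peakIndicator-above {z} {a} l a<b rewrite <ᵇ-false (<⇒≤ a<b) | ∧-zeroʳ (z <ᵇ a) = refl

  interiorPeaks-below : ∀ {z a} l → a ≤ z → interiorPeaks (z ∷ a ∷ l) ≡ interiorPeaks (a ∷ l)
  interiorPeaks-below l a≤z = trans (interiorPeaks-∷ _ _ l) (cong (_+ _) (peakIndicator-below l a≤z))

  interiorPeaks-peak : ∀ {M} z a b l → a < M → b < M →
                       interiorPeaks (z ∷ a ∷ M ∷ b ∷ l) ≡ suc (interiorPeaks (b ∷ l))
  interiorPeaks-peak z a b l a<M b<M
    rewrite peakIndicator-above {z} (b ∷ l) a<M | <ᵇ-true a<M | <ᵇ-true b<M =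
    cong suc (interiorPeaks-below l (<⇒≤ b<M))

  data AdjacentPeaks : ℕ → ℕ → Set where
    neither : AdjacentPeaks 0 0
    right   : AdjacentPeaks 0 1
    left    : AdjacentPeaks 1 0

  adjacentPeaks : ∀ z a b l → AdjacentPeaks (peakIndicator z a (b ∷ l)) (peakIndicator a b l)
  adjacentPeaks z a b l with (z <ᵇ a) ∧ (b <ᵇ a) in a-peak
  ... | true
    rewrite peakIndicator-below l
              (<⇒≤ (<ᵇ⇒< b a (proj₂ (Equivalence.to T-∧ (subst Bool.T (sym a-peak) tt)))))
    = left
  adjacentPeaks z a b [] | false = neither
  adjacentPeaks z a b (d ∷ l) | false with (a <ᵇ b) ∧ (d <ᵇ b)
  ... | true = right
  ... | false = neither

  interiorPeaks-bound : ∀ a l → 2 * interiorPeaks (a ∷ l) ≤ length l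
  interiorPeaks-bound a [] = z≤n
  interiorPeaks-bound a (b ∷ []) = z≤n
  interiorPeaks-bound a (b ∷ c ∷ r) =
    subst (λ p → 2 * (peakIndicator a b (c ∷ r) + p) ≤ suc (suc (length r))) (sym (interiorPeaks-∷ b c r))
      (step (adjacentPeaks a b c r)
            (subst (λ p → 2 * p ≤ suc (length r)) (interiorPeaks-∷ b c r) (interiorPeaks-bound b (c ∷ r)))
            (interiorPeaks-bound c r))
    where
    step : ∀ {x y q L} → AdjacentPeaks x y → 2 * (y + q) ≤ suc L → 2 * q ≤ L →
           2 * (x + (y + q)) ≤ suc (suc L)
    step neither 2q≤1+L _ = m≤n⇒m≤1+n 2q≤1+L
    step {q = q} right _ 2q≤L rewrite +-suc q (q + 0) = s≤s (s≤s 2q≤L)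
    step {q = q} left _ 2q≤L rewrite +-suc q (q + 0) = s≤s (s≤s 2q≤L)

  interiorPeaks-map-suc : ∀ l → interiorPeaks (map suc l) ≡ interiorPeaks l
  interiorPeaks-map-suc [] = refl
  interiorPeaks-map-suc (a ∷ []) = refl
  interiorPeaks-map-suc (a ∷ b ∷ []) = refl
  interiorPeaks-map-suc (a ∷ b ∷ c ∷ r) = cong (_ +_) (interiorPeaks-map-suc (b ∷ c ∷ r))

  exteriorPeaks-sentinel : ∀ π → exteriorPeaks π ≡ interiorPeaks (0 ∷ map suc π)
  exteriorPeaks-sentinel [] = refl
  exteriorPeaks-sentinel (a ∷ []) = refl
  exteriorPeaks-sentinel (a ∷ b ∷ r) = cong (_ +_) (sym (interiorPeaks-map-suc (a ∷ b ∷ r)))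

  exteriorPeaks-bound : ∀ π → 2 * exteriorPeaks π ≤ length π
  exteriorPeaks-bound π =
    subst₂ _≤_ (cong (2 *_) (sym (exteriorPeaks-sentinel π))) (length-map suc π)
      (interiorPeaks-bound 0 (map suc π))

  half-bound : ∀ {e n} → 2 * e ≤ n → e < suc (n / 2)
  half-bound {e} {n} 2e≤n =
    s≤s (subst (_≤ n / 2) (m*n/n≡m e 2) (/-monoˡ-≤ 2 (subst (_≤ n) (*-comm 2 e) 2e≤n)))

open Peaks

module PeakInsertion {c ℓ} (R : CommutativeSemiring c ℓ) where

  open import Data.List using ([]; _∷_; map; length)
  open import Data.List.Properties using (length-map)
  open import Data.List.Relation.Unary.All as All using (All; []; _∷_)
  open import Data.List.Relation.Unary.All.Properties using () renaming (map⁺ to All-map⁺)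
  open import Data.Nat using (_+_; _*_; _∸_; _<_; z<s; s<s)
  open import Data.Nat.Properties using (+-∸-assoc; +-suc; ≤-refl)
  open import Function using (_∘_)
  import Relation.Binary.PropositionalEquality as ≡

  open CommutativeSemiring R renaming (_+_ to _+ᴿ_; _*_ to _*ᴿ_)
  open import Algebra.Properties.CommutativeSemigroup +-commutativeSemigroup using (x∙yz≈y∙xz)
  open import Algebra.Properties.Semiring.Mult semiring using (_×_)
  open import Relation.Binary.Reasoning.Setoid setoid
  open FiniteSums R

  absorb-insertion : ∀ (f : ℕ → Carrier) {δ δ′} → AdjacentPeaks δ δ′ → ∀ q L → 2 * q ≤ L →
    f (suc q) +ᴿ ((1 + δ′ + 2 * q) × f (δ + (δ′ + q))
                  +ᴿ (L ∸ (δ′ + 2 * q)) × f (δ + suc (δ′ + q)))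
      ≈ (1 + δ + 2 * (δ′ + q)) × f (δ + (δ′ + q))
        +ᴿ (suc L ∸ (δ + 2 * (δ′ + q))) × f (suc (δ + (δ′ + q)))
  absorb-insertion f neither q L 2q≤L rewrite +-∸-assoc 1 2q≤L = x∙yz≈y∙xz _ _ _
  absorb-insertion f right q L _ rewrite +-suc q (q + 0) = sym (+-assoc _ _ _)
  absorb-insertion f left q L _ = sym (+-assoc _ _ _)

  -- Of the insertion points after a, those next to a peak and the last one keep the
  -- number of peaks, and the others add one.
  ∑-insertions-after : ∀ {M} (f : ℕ → Carrier) z a l → a < M → All (_< M) l →
    ∑ (λ l′ → f (interiorPeaks (z ∷ a ∷ l′))) (insertions M l)
      ≈ (1 + peakIndicator z a l + 2 * interiorPeaks (a ∷ l)) × f (peakIndicator z a l + interiorPeaks (a ∷ l))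
        +ᴿ (length l ∸ (peakIndicator z a l + 2 * interiorPeaks (a ∷ l)))
           × f (suc (peakIndicator z a l + interiorPeaks (a ∷ l)))
  ∑-insertions-after f z a [] a<M [] rewrite peakIndicator-above {z} [] a<M = sym (+-identityʳ _)
  ∑-insertions-after {M} f z a (b ∷ l) a<M (b<M ∷ l<M) rewrite interiorPeaks-∷ a b l = begin
    f (interiorPeaks (z ∷ a ∷ M ∷ b ∷ l))
      +ᴿ ∑ (λ l′ → f (interiorPeaks (z ∷ a ∷ l′))) (map (b ∷_) (insertions M l))
      ≡⟨ ≡.cong₂ _+ᴿ_ (≡.cong f (interiorPeaks-peak z a b l a<M b<M))
                      (∑-map _ (b ∷_) (insertions M l)) ⟩
    f (suc (interiorPeaks (b ∷ l))) +ᴿ ∑ (λ l′ → f (δ + interiorPeaks (a ∷ b ∷ l′))) (insertions M l)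
      ≈⟨ +-congˡ (∑-insertions-after (f ∘ (δ +_)) a b l b<M l<M) ⟩
    _ ≈⟨ absorb-insertion f (adjacentPeaks z a b l) (interiorPeaks (b ∷ l)) (length l)
                          (interiorPeaks-bound b l) ⟩
    _ ∎
    where δ = peakIndicator z a (b ∷ l)

  -- Repeating z changes no peak and puts every insertion point after the second entry.
  ∑-insertions-interiorPeaks : ∀ {M} (f : ℕ → Carrier) z l → z < M → All (_< M) l →
    ∑ (λ l′ → f (interiorPeaks (z ∷ l′))) (insertions M l)
      ≈ (1 + 2 * interiorPeaks (z ∷ l)) × f (interiorPeaks (z ∷ l))
        +ᴿ (length l ∸ 2 * interiorPeaks (z ∷ l)) × f (suc (interiorPeaks (z ∷ l)))
  ∑-insertions-interiorPeaks {M} f z l z<M l<M = begin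
    ∑ (λ l′ → f (interiorPeaks (z ∷ l′))) (insertions M l)
      ≈⟨ ∑-cong (insertions M l) (λ {l′} _ → reflexive (≡.cong f (interiorPeaks-below l′ ≤-refl))) ⟨
    ∑ (λ l′ → f (interiorPeaks (z ∷ z ∷ l′))) (insertions M l)
      ≈⟨ ∑-insertions-after f z z l z<M l<M ⟩
    _ ≡⟨ ≡.cong (λ δ → (1 + δ + 2 * q) × f (δ + q) +ᴿ (length l ∸ (δ + 2 * q)) × f (suc (δ + q)))
                (peakIndicator-below l ≤-refl) ⟩
    _ ∎
    where q = interiorPeaks (z ∷ l)

  ∑-insertions-exteriorPeaks : ∀ {M} (f : ℕ → Carrier) π → All (_< M) π →
    ∑ (f ∘ exteriorPeaks) (insertions M π)
      ≈ (1 + 2 * exteriorPeaks π) × f (exteriorPeaks π)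
        +ᴿ (length π ∸ 2 * exteriorPeaks π) × f (suc (exteriorPeaks π))
  ∑-insertions-exteriorPeaks {M} f π π<M = begin
    ∑ (f ∘ exteriorPeaks) (insertions M π)
      ≈⟨ ∑-cong (insertions M π) (λ {π′} _ → reflexive (≡.cong f (exteriorPeaks-sentinel π′))) ⟩
    ∑ (λ π′ → f (interiorPeaks (0 ∷ map suc π′))) (insertions M π)
      ≡⟨ ∑-map (λ l′ → f (interiorPeaks (0 ∷ l′))) (map suc) (insertions M π) ⟨
    ∑ (λ l′ → f (interiorPeaks (0 ∷ l′))) (map (map suc) (insertions M π))
      ≡⟨ ≡.cong (∑ (λ l′ → f (interiorPeaks (0 ∷ l′)))) (insertions-map suc M π) ⟩
    ∑ (λ l′ → f (interiorPeaks (0 ∷ l′))) (insertions (suc M) (map suc π))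
      ≈⟨ ∑-insertions-interiorPeaks f 0 (map suc π) z<s (All-map⁺ (All.map s<s π<M)) ⟩
    _ ≡⟨ ≡.cong₂ (λ e n → (1 + 2 * e) × f e +ᴿ (n ∸ 2 * e) × f (suc e))
                 (≡.sym (exteriorPeaks-sentinel π)) (length-map suc π) ⟩
    _ ∎

module RightHandSide where

  open import Data.List using ([]; _∷_; foldr; upTo; concatMap)
  open import Data.List.Membership.Propositional using (_∈_)
  open import Data.List.Membership.Propositional.Properties using (∈-upTo⁺)
  import Data.List.Relation.Unary.All as All
  open import Data.List.Relation.Unary.Unique.Propositional.Properties using (upTo⁺)
  open import Data.Nat using (_+_; _*_; _∸_; _<_; _/_)
  import Data.Nat.Properties as ℕ
  open import Data.Product using (_,_)
  open import Function using (_∘_)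
  import Relation.Binary.PropositionalEquality as ≡
  open ≡ using (_≡_)

  peakMonomial : ℕ → ℕ → Expr
  peakMonomial n e = X ^ᴱ (2 * e + 1) ⊗ Y ^ᴱ (n ∸ 2 * e)

  rhsTerm : ℕ → ℕ → Expr
  rhsTerm n k = lit (T n k) ⊗ X ^ᴱ (2 * k + 1) ⊗ Y ^ᴱ (n ∸ 2 * k)

  D-foldr-⊕ : ∀ (G : ℕ → Expr) ks →
              D (foldr (λ k acc → G k ⊕ acc) (lit 0) ks) ≡ foldr (λ k acc → D (G k) ⊕ acc) (lit 0) ks
  D-foldr-⊕ G [] = ≡.refl
  D-foldr-⊕ G (k ∷ ks) = ≡.cong (D (G k) ⊕_) (D-foldr-⊕ G ks)

  exteriorPeaks-perms : ∀ {n π} → π ∈ perms n → exteriorPeaks π < suc (n / 2)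
  exteriorPeaks-perms {n} {π} π∈ with len , _ ← ∈-perms⁻ {n} π∈ =
    half-bound (≡.subst (2 * exteriorPeaks π ≤_) len (exteriorPeaks-bound π))

  module Evaluation {c ℓ} (R : CommutativeSemiring c ℓ) (a b : CommutativeSemiring.Carrier R) where
    open CommutativeSemiring R renaming (_+_ to _+ᴿ_; _*_ to _*ᴿ_)
    open import Algebra.Definitions.RawSemiring rawSemiring using (_^_)
    open import Algebra.Properties.Semiring.Mult semiring using (_×_; ×-congʳ; ×-assoc-*; ×-comm-*)
    open import Algebra.Solver.Ring.NaturalCoefficients.Default R using (solve; _:=_; _:+_; _:*_; con)
    open import Relation.Binary.Reasoning.Setoid setoid
    open FiniteSums R
    open PeakInsertion R

    ev : Expr → Carrier
    ev e = ⟦ R ⟧ e a b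

    ev-lit-* : ∀ n x → ev (lit n) *ᴿ x ≈ n × x
    ev-lit-* zero x = zeroˡ x
    ev-lit-* (suc n) x = trans (distribʳ x 1# _) (+-cong (*-identityˡ x) (ev-lit-* n x))

    ev-^ᴱ : ∀ e i → ev (e ^ᴱ i) ≈ ev e ^ i
    ev-^ᴱ e zero = +-identityʳ 1#
    ev-^ᴱ e (suc i) = *-congˡ (ev-^ᴱ e i)

    ev-D-^ᴱ : ∀ e i → ev (D (e ^ᴱ suc i)) ≈ suc i × (ev e ^ i *ᴿ ev (D e))
    ev-D-^ᴱ e zero =
      +-cong (trans (*-congˡ (+-identityʳ 1#)) (trans (*-identityʳ _) (sym (*-identityˡ _)))) (zeroʳ _)
    ev-D-^ᴱ e (suc i) = begin
      ev (D e) *ᴿ ev (e ^ᴱ suc i) +ᴿ ev e *ᴿ ev (D (e ^ᴱ suc i))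
        ≈⟨ +-cong (*-comm _ _) (*-congˡ (ev-D-^ᴱ e i)) ⟩
      ev (e ^ᴱ suc i) *ᴿ ev (D e) +ᴿ ev e *ᴿ (suc i × (ev e ^ i *ᴿ ev (D e)))
        ≈⟨ +-cong (*-congʳ (ev-^ᴱ e (suc i))) (×-comm-* (suc i) _ _) ⟩
      ev e ^ suc i *ᴿ ev (D e) +ᴿ suc i × (ev e *ᴿ (ev e ^ i *ᴿ ev (D e)))
        ≈⟨ +-congˡ (×-congʳ (suc i) (sym (*-assoc _ _ _))) ⟩
      suc (suc i) × (ev e ^ suc i *ᴿ ev (D e)) ∎

    ev-D-X^ᴱ : ∀ i → ev (D (X ^ᴱ i)) ≈ i × (a ^ i *ᴿ b)
    ev-D-X^ᴱ zero = refl
    ev-D-X^ᴱ (suc i) =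
      trans (ev-D-^ᴱ X i) (×-congʳ (suc i) (trans (sym (*-assoc _ _ _)) (*-congʳ (*-comm _ _))))

    ev-D-Y^ᴱ : ∀ j → ev (D (Y ^ᴱ j)) ≈ j × (a *ᴿ a *ᴿ b ^ (j ∸ 1))
    ev-D-Y^ᴱ zero = refl
    ev-D-Y^ᴱ (suc j) = trans (ev-D-^ᴱ Y j) (×-congʳ (suc j) (*-comm _ _))

    ev-D-monomial : ∀ i j → ev (D (X ^ᴱ i ⊗ Y ^ᴱ j))
                            ≈ i × ev (X ^ᴱ i ⊗ Y ^ᴱ suc j) +ᴿ j × ev (X ^ᴱ (2 + i) ⊗ Y ^ᴱ (j ∸ 1))
    ev-D-monomial i j = begin
      ev (D (X ^ᴱ i)) *ᴿ ev (Y ^ᴱ j) +ᴿ ev (X ^ᴱ i) *ᴿ ev (D (Y ^ᴱ j))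
        ≈⟨ +-cong (*-cong (ev-D-X^ᴱ i) (ev-^ᴱ Y j)) (*-cong (ev-^ᴱ X i) (ev-D-Y^ᴱ j)) ⟩
      (i × (a ^ i *ᴿ b)) *ᴿ b ^ j +ᴿ a ^ i *ᴿ (j × (a *ᴿ a *ᴿ b ^ (j ∸ 1)))
        ≈⟨ +-cong (×-assoc-* i _ _) (×-comm-* j _ _) ⟩
      i × ((a ^ i *ᴿ b) *ᴿ b ^ j) +ᴿ j × (a ^ i *ᴿ (a *ᴿ a *ᴿ b ^ (j ∸ 1)))
        ≈⟨ +-cong (×-congʳ i (*-assoc _ _ _))
                  (×-congʳ j (solve 3 (λ p x y → p :* (x :* x :* y) := (x :* (x :* p)) :* y)
                                      refl (a ^ i) a (b ^ (j ∸ 1)))) ⟩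
      i × (a ^ i *ᴿ b ^ suc j) +ᴿ j × (a ^ (2 + i) *ᴿ b ^ (j ∸ 1))
        ≈⟨ +-cong (×-congʳ i (*-cong (ev-^ᴱ X i) (ev-^ᴱ Y (suc j))))
                  (×-congʳ j (*-cong (ev-^ᴱ X (2 + i)) (ev-^ᴱ Y (j ∸ 1)))) ⟨
      i × ev (X ^ᴱ i ⊗ Y ^ᴱ suc j) +ᴿ j × ev (X ^ᴱ (2 + i) ⊗ Y ^ᴱ (j ∸ 1)) ∎

    ev-D-peakMonomial : ∀ n e → 2 * e ≤ n →
      ev (D (peakMonomial n e))
        ≈ (1 + 2 * e) × ev (peakMonomial (suc n) e) +ᴿ (n ∸ 2 * e) × ev (peakMonomial (suc n) (suc e))
    ev-D-peakMonomial n e 2e≤n = trans (ev-D-monomial (2 * e + 1) (n ∸ 2 * e)) (reflexive (≡.cong₂ _+ᴿ_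
      (≡.cong₂ (λ k j → k × ev (X ^ᴱ (2 * e + 1) ⊗ Y ^ᴱ j)) (ℕ.+-comm (2 * e) 1) y-same)
      (≡.cong₂ (λ i j → (n ∸ 2 * e) × ev (X ^ᴱ i ⊗ Y ^ᴱ j)) x-next y-next)))
      where
      y-same : suc (n ∸ 2 * e) ≡ suc n ∸ 2 * e
      y-same = ≡.sym (ℕ.+-∸-assoc 1 2e≤n)
      x-next : 2 + (2 * e + 1) ≡ 2 * suc e + 1
      x-next = ≡.cong (_+ 1) (≡.sym (ℕ.*-suc 2 e))
      y-next : n ∸ 2 * e ∸ 1 ≡ suc n ∸ 2 * suc e
      y-next = ≡.trans (ℕ.∸-+-assoc n (2 * e) 1)
                 (≡.trans (≡.cong (n ∸_) (ℕ.+-comm (2 * e) 1)) (≡.cong (suc n ∸_) (≡.sym (ℕ.*-suc 2 e))))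

    ev-foldr-⊕ : ∀ (G : ℕ → Expr) ks → ev (foldr (λ k acc → G k ⊕ acc) (lit 0) ks) ≡ ∑ (ev ∘ G) ks
    ev-foldr-⊕ G [] = ≡.refl
    ev-foldr-⊕ G (k ∷ ks) = ≡.cong (ev (G k) +ᴿ_) (ev-foldr-⊕ G ks)

    ev-rhsTerm : ∀ n k → ev (rhsTerm n k) ≈ T n k × ev (peakMonomial n k)
    ev-rhsTerm n k = trans (*-assoc _ _ _) (ev-lit-* (T n k) _)

    ev-D-rhsTerm : ∀ n k → ev (D (rhsTerm n k)) ≈ T n k × ev (D (peakMonomial n k))
    ev-D-rhsTerm n k = trans
      (solve 5 (λ l p dp q dq → (con 0 :* p :+ l :* dp) :* q :+ (l :* p) :* dq := l :* (dp :* q :+ p :* dq))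
             refl (ev (lit (T n k))) (ev (X ^ᴱ (2 * k + 1))) (ev (D (X ^ᴱ (2 * k + 1))))
                  (ev (Y ^ᴱ (n ∸ 2 * k))) (ev (D (Y ^ᴱ (n ∸ 2 * k)))))
      (ev-lit-* (T n k) _)

    ∑-T : ∀ n (h : ℕ → Carrier) →
          ∑ (λ k → T n k × h k) (upTo (suc (n / 2))) ≈ ∑ (h ∘ exteriorPeaks) (perms n)
    ∑-T n h =
      ∑-group exteriorPeaks h (perms n) (upTo⁺ _) (All.tabulate (∈-upTo⁺ ∘ exteriorPeaks-perms {n}))

    ev-rhs : ∀ n → ev (rhs n) ≈ ∑ (ev ∘ peakMonomial n ∘ exteriorPeaks) (perms n)
    ev-rhs n = begin
      ev (rhs n)                                         ≡⟨ ev-foldr-⊕ (rhsTerm n) ks ⟩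
      ∑ (ev ∘ rhsTerm n) ks                              ≈⟨ ∑-cong ks (λ {k} _ → ev-rhsTerm n k) ⟩
      ∑ (λ k → T n k × ev (peakMonomial n k)) ks         ≈⟨ ∑-T n _ ⟩
      ∑ (ev ∘ peakMonomial n ∘ exteriorPeaks) (perms n)  ∎
      where ks = upTo (suc (n / 2))

    ev-D-rhs : ∀ n → ev (D (rhs n)) ≈ ∑ (ev ∘ D ∘ peakMonomial n ∘ exteriorPeaks) (perms n)
    ev-D-rhs n = begin
      ev (D (rhs n))                                          ≡⟨ ≡.cong ev (D-foldr-⊕ (rhsTerm n) ks) ⟩
      ev (foldr (λ k acc → D (rhsTerm n k) ⊕ acc) (lit 0) ks) ≡⟨ ev-foldr-⊕ (D ∘ rhsTerm n) ks ⟩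
      ∑ (ev ∘ D ∘ rhsTerm n) ks                               ≈⟨ ∑-cong ks (λ {k} _ → ev-D-rhsTerm n k) ⟩
      ∑ (λ k → T n k × ev (D (peakMonomial n k))) ks          ≈⟨ ∑-T n _ ⟩
      ∑ (ev ∘ D ∘ peakMonomial n ∘ exteriorPeaks) (perms n)   ∎
      where ks = upTo (suc (n / 2))

    ev-D-peakMonomial-insertions : ∀ {n π} → IsPermutation n π →
      ev (D (peakMonomial n (exteriorPeaks π)))
        ≈ ∑ (ev ∘ peakMonomial (suc n) ∘ exteriorPeaks) (insertions n π)
    ev-D-peakMonomial-insertions {n} {π} (≡.refl , bounded , _) =
      trans (ev-D-peakMonomial n (exteriorPeaks π) (exteriorPeaks-bound π))
            (sym (∑-insertions-exteriorPeaks (ev ∘ peakMonomial (suc n)) π bounded))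

    ev-D-rhs≈ev-rhs-suc : ∀ n → ev (D (rhs n)) ≈ ev (rhs (suc n))
    ev-D-rhs≈ev-rhs-suc n = begin
      ev (D (rhs n))
        ≈⟨ ev-D-rhs n ⟩
      ∑ (ev ∘ D ∘ peakMonomial n ∘ exteriorPeaks) (perms n)
        ≈⟨ ∑-cong (perms n) (ev-D-peakMonomial-insertions ∘ ∈-perms⁻ {n}) ⟩
      ∑ (∑ weight ∘ insertions n) (perms n)
        ≈⟨ ∑-concatMap weight (insertions n) (perms n) ⟨
      ∑ weight (concatMap (insertions n) (perms n))
        ≈⟨ ∑-↭ weight (perms-suc-↭ n) ⟨
      ∑ weight (perms (suc n))
        ≈⟨ ev-rhs (suc n) ⟨
      ev (rhs (suc n)) ∎
      where weight = ev ∘ peakMonomial (suc n) ∘ exteriorPeaks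

  D-rhs : ∀ n → D (rhs n) ≈ᴾ rhs (suc n)
  D-rhs n R a b = Evaluation.ev-D-rhs≈ev-rhs-suc R a b n

  X≈ᴾrhs-zero : X ≈ᴾ rhs 0
  X≈ᴾrhs-zero R a b = solve 1 (λ x → x := one :* (x :* one) :* one :+ con 0) refl a
    where
    open CommutativeSemiring R
    open import Algebra.Solver.Ring.NaturalCoefficients.Default R using (solve; _:=_; _:+_; _:*_; con)
    one = con 1 :+ con 0

open RightHandSide using (D-rhs; X≈ᴾrhs-zero)

D^X≈ᴾrhs : ∀ n → D^ n X ≈ᴾ rhs n
D^X≈ᴾrhs zero = X≈ᴾrhs-zero
D^X≈ᴾrhs (suc n) R a b =
  CommutativeSemiring.trans R (D-cong {D^ n X} {rhs n} (D^X≈ᴾrhs n) R a b) (D-rhs n R a b)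

theorem4p1 : (n : ℕ) → 1 ≤ n → D^ n X ≈ᴾ rhs n
theorem4p1 n _ = D^X≈ᴾrhs n
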